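{- Let $G$ be a finite abelian group, let $A \subset \mathbb{Z}$ be a non-empty subset, and let $b$ be an integer. Then $\mathsf{D}_{bA}(G) = \mathsf{D}_{A}(\gcd(b,\exp(G))\, G)$, where $bA = \{ba \colon a \in A\}$ and for an integer $d$, $dG = \{dg \colon g \in G\}$.
   Context: Groups are written additively; $\exp(G)$ is the exponent of $G$. For a finite abelian group $H$ and a non-empty set of weights $A \subset \mathbb{Z}$, the $A$-weighted Davenport constant $\mathsf{D}_A(H)$ is the smallest positive integer $\ell$ such that for every sequence $g_1, \dots, g_k$ of elements of $H$ (repetitions allowed) with $k \ge \ell$ there exist a non-empty subset $I \subset \{1,\dots,k\}$ and weights $a_i \in A$ ($i \in I$) with $\sum_{i\in I} a_i g_i = 0$. -}

module Defs where

open import Level using (Level; _⊔_)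
open import Algebra.Bundles using (AbelianGroup)
open import Data.Nat as ℕ using (ℕ; zero; suc; _≤_; _≥_)
open import Data.Integer as ℤ using (ℤ; +_; -[1+_])
open import Data.Fin as Fin using (Fin)
open import Data.Vec using (_∷_)
open import Data.Bool using (true; false)
open import Data.Fin.Subset using (Subset; _∈_; Nonempty)
open import Data.Product using (Σ; ∃; ∃-syntax; _×_; _,_)
open import Data.Unit.Polymorphic using (⊤)
open import Relation.Binary.PropositionalEquality using (_≡_)
open import Relation.Unary using (Pred)
import Algebra.Definitions.RawMonoid as RawMonoidDefs

module _ {c ℓ : Level} (G : AbelianGroup c ℓ) where
  open AbelianGroup G

  _·ℕ_ : ℕ → Carrier → Carrier
  n ·ℕ g = RawMonoidDefs._×_ rawMonoid n g

  _·ℤ_ : ℤ → Carrier → Carrier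
  (+ n) ·ℤ g = n ·ℕ g
  -[1+ n ] ·ℤ g = (suc n ·ℕ g) ⁻¹

  IsFinite : Set (c ⊔ ℓ)
  IsFinite = ∃[ n ] Σ (Fin n → Carrier) λ f → ∀ x → ∃[ i ] f i ≈ x

  IsExponent : ℕ → Set (c ⊔ ℓ)
  IsExponent e =
    1 ≤ e × (∀ g → e ·ℕ g ≈ ε) × (∀ m → 1 ≤ m → (∀ g → m ·ℕ g ≈ ε) → e ≤ m)

  _·G : ℤ → Pred Carrier (c ⊔ ℓ)
  (d ·G) x = ∃[ g ] x ≈ d ·ℤ g

  whole : Pred Carrier ℓ
  whole _ = ⊤

  weightedSum : ∀ {k} → Subset k → (Fin k → ℤ) → (Fin k → Carrier) → Carrier
  weightedSum {zero} I a g = ε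
  weightedSum {suc k} (true ∷ I) a g =
    (a Fin.zero ·ℤ g Fin.zero) ∙ weightedSum I (λ i → a (Fin.suc i)) (λ i → g (Fin.suc i))
  weightedSum {suc k} (false ∷ I) a g =
    weightedSum I (λ i → a (Fin.suc i)) (λ i → g (Fin.suc i))

  HasWeightedZeroSum : ∀ {a} → Pred ℤ a → ∀ {k} → (Fin k → Carrier) → Set (a ⊔ ℓ)
  HasWeightedZeroSum A {k} g =
    Σ (Subset k) λ I → Nonempty I ×
      (Σ (Fin k → ℤ) λ w → (∀ i → i ∈ I → A (w i)) × (weightedSum I w g ≈ ε))

  DavenportBound : ∀ {a h} → Pred ℤ a → Pred Carrier h → ℕ → Set (a ⊔ c ⊔ ℓ ⊔ h)
  DavenportBound A H m =
    ∀ k → m ≤ k → (g : Fin k → Carrier) → (∀ i → H (g i)) → HasWeightedZeroSum A g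

  IsWeightedDavenport : ∀ {a h} → Pred ℤ a → Pred Carrier h → ℕ → Set (a ⊔ c ⊔ ℓ ⊔ h)
  IsWeightedDavenport A H n =
    1 ≤ n × DavenportBound A H n × (∀ m → 1 ≤ m → DavenportBound A H m → n ≤ m)

_·ₛ_ : ∀ {a} → ℤ → Pred ℤ a → Pred ℤ a
(b ·ₛ A) x = ∃[ y ] A y × x ≡ b ℤ.* y

{-# OPTIONS --safe #-}
-- Since multiplication by b is a homomorphism G → bG, an A-weighted zero-sum
-- of (b g_i) is the same thing as a bA-weighted zero-sum of (g_i); so the
-- bA-weighted constant of G is the A-weighted constant of bG. And bG = dG for
-- d = gcd(|b|, e): the inclusion bG ⊆ dG holds as d ∣ |b|, and dG ⊆ |b|G = bG
-- by Bézout, d ≡ u |b| modulo e.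
module Submission where

open import Defs
open import Level using (Level)
open import Algebra.Bundles using (AbelianGroup)
open import Data.Nat using (ℕ)
open import Data.Nat.GCD using (gcd)
open import Data.Integer using (ℤ; +_; ∣_∣)
open import Data.Product using (∃)
open import Function.Bundles using (_⇔_)
open import Relation.Unary using (Pred)

import Algebra.Properties.AbelianGroup as AbelianGroupProperties
import Algebra.Properties.Monoid.Mult as MonoidMultProperties
open import Data.Bool using (true; false)
open import Data.Fin using (Fin; zero; suc)
open import Data.Fin.Subset using (Subset; _∈_)
open import Data.Fin.Subset.Properties using (_∈?_)
open import Data.Integer using (-[1+_]; sign; _◃_)
open import Data.Nat.Divisibility using (divides)
open import Data.Nat.GCD using (gcd[m,n]∣m; gcd-GCD; module Bézout)
open import Data.Product using (_,_; proj₁; proj₂)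
open import Data.Sign using (Sign)
open import Data.Unit.Polymorphic using (tt)
open import Data.Vec.Base using (_∷_; here; there)
open import Function.Bundles using (mk⇔; Equivalence)
open import Function.Construct.Composition using (_⇔-∘_)
open import Relation.Binary.PropositionalEquality as ≡ using (_≡_)
open import Relation.Nullary using (Dec; yes; no; contradiction)
open import Relation.Unary using (_⊆_; _≐_)
open import Relation.Unary.Properties using (≐-trans)
import Data.Integer as ℤ
import Data.Nat as ℕ
import Data.Nat.Properties as ℕ
import Data.Sign as Sign
import Data.Sign.Properties as Sign
import Relation.Binary.Reasoning.Setoid as SetoidReasoning

choose-on-subset : ∀ {a p k} {A : Set a} {P : Fin k → A → Set p} → A → (I : Subset k) →
  (∀ i → i ∈ I → ∃ (P i)) → ∃ λ f → ∀ i → i ∈ I → P i (f i)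
choose-on-subset {A = A} {P} default I choice = (λ i → value i (i ∈? I)) , λ i → valid i (i ∈? I)
  where
  value : ∀ i → Dec (i ∈ I) → A
  value i (yes i∈I) = proj₁ (choice i i∈I)
  value i (no _)    = default
  valid : ∀ i (i∈?I : Dec (i ∈ I)) → i ∈ I → P i (value i i∈?I)
  valid i (yes i∈I) _   = proj₂ (choice i i∈I)
  valid i (no i∉I)  i∈I = contradiction i∈I i∉I

module _ {c ℓ} (G : AbelianGroup c ℓ) where
  open AbelianGroup G
  open AbelianGroupProperties G using (⁻¹-∙-comm; ε⁻¹≈ε; ⁻¹-involutive; inverseˡ-unique)
  open MonoidMultProperties monoid using (_×_; ×-congʳ; ×-homo-+; ×-assocˡ)
  open SetoidReasoning setoid

  infixr 8 _⊙_
  _⊙_ : ℤ → Carrier → Carrier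
  _⊙_ = _·ℤ_ G

  ×-ε : ∀ n → n × ε ≈ ε
  ×-ε ℕ.zero    = refl
  ×-ε (ℕ.suc n) = trans (identityˡ _) (×-ε n)

  ×-⁻¹ : ∀ n x → n × (x ⁻¹) ≈ (n × x) ⁻¹
  ×-⁻¹ ℕ.zero    x = sym ε⁻¹≈ε
  ×-⁻¹ (ℕ.suc n) x = trans (∙-congˡ (×-⁻¹ n x)) (⁻¹-∙-comm x (n × x))

  signed : Sign → Carrier → Carrier
  signed Sign.+ x = x
  signed Sign.- x = x ⁻¹

  signed-cong : ∀ s {x y} → x ≈ y → signed s x ≈ signed s y
  signed-cong Sign.+ x≈y = x≈y
  signed-cong Sign.- x≈y = ⁻¹-cong x≈y

  ×-signed : ∀ n s x → n × signed s x ≈ signed s (n × x)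
  ×-signed n Sign.+ x = refl
  ×-signed n Sign.- x = ×-⁻¹ n x

  signed-* : ∀ s t x → signed s (signed t x) ≈ signed (s Sign.* t) x
  signed-* Sign.+ t      x = refl
  signed-* Sign.- Sign.+ x = refl
  signed-* Sign.- Sign.- x = ⁻¹-involutive x

  signed-involutive : ∀ s x → signed s (signed s x) ≈ x
  signed-involutive Sign.+ x = refl
  signed-involutive Sign.- x = ⁻¹-involutive x

  ◃-⊙ : ∀ s n x → (s ◃ n) ⊙ x ≈ signed s (n × x)
  ◃-⊙ Sign.+ ℕ.zero    x = refl
  ◃-⊙ Sign.- ℕ.zero    x = sym ε⁻¹≈ε
  ◃-⊙ Sign.+ (ℕ.suc n) x = refl
  ◃-⊙ Sign.- (ℕ.suc n) x = refl

  ⊙-signAbs : ∀ z x → z ⊙ x ≈ signed (sign z) (∣ z ∣ × x)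
  ⊙-signAbs (+ n)    x = refl
  ⊙-signAbs -[1+ n ] x = refl

  ⊙-abs : ∀ z x → z ⊙ x ≈ ∣ z ∣ × signed (sign z) x
  ⊙-abs z x = trans (⊙-signAbs z x) (sym (×-signed ∣ z ∣ (sign z) x))

  ⊙-congʳ : ∀ z {x y} → x ≈ y → z ⊙ x ≈ z ⊙ y
  ⊙-congʳ (+ n)    x≈y = ×-congʳ n x≈y
  ⊙-congʳ -[1+ n ] x≈y = ⁻¹-cong (×-congʳ (ℕ.suc n) x≈y)

  *-⊙ : ∀ y z x → (y ℤ.* z) ⊙ x ≈ z ⊙ (y ⊙ x)
  *-⊙ y z x = begin
    (y ℤ.* z) ⊙ x
      ≈⟨ ◃-⊙ (sign y Sign.* sign z) (∣ y ∣ ℕ.* ∣ z ∣) x ⟩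
    signed (sign y Sign.* sign z) ((∣ y ∣ ℕ.* ∣ z ∣) × x)
      ≡⟨ ≡.cong₂ (λ s n → signed s (n × x)) (Sign.*-comm (sign y) (sign z)) (ℕ.*-comm ∣ y ∣ ∣ z ∣) ⟩
    signed (sign z Sign.* sign y) ((∣ z ∣ ℕ.* ∣ y ∣) × x)
      ≈⟨ signed-cong (sign z Sign.* sign y) (sym (×-assocˡ x ∣ z ∣ ∣ y ∣)) ⟩
    signed (sign z Sign.* sign y) (∣ z ∣ × ∣ y ∣ × x)
      ≈⟨ sym (signed-* (sign z) (sign y) _) ⟩
    signed (sign z) (signed (sign y) (∣ z ∣ × ∣ y ∣ × x))
      ≈⟨ signed-cong (sign z) (sym (×-signed ∣ z ∣ (sign y) _)) ⟩
    signed (sign z) (∣ z ∣ × signed (sign y) (∣ y ∣ × x))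
      ≈⟨ signed-cong (sign z) (×-congʳ ∣ z ∣ (sym (⊙-signAbs y x))) ⟩
    signed (sign z) (∣ z ∣ × (y ⊙ x))
      ≈⟨ sym (⊙-signAbs z (y ⊙ x)) ⟩
    z ⊙ (y ⊙ x) ∎

  ·G-abs : ∀ z → _·G G z ≐ _·G G (+ ∣ z ∣)
  ·G-abs z = (λ { (x , y≈z⊙x) → signed (sign z) x , trans y≈z⊙x (⊙-abs z x) })
           , (λ { (x , y≈∣z∣×x) → signed (sign z) x , trans y≈∣z∣×x (sym (z⊙signed x)) })
    where
    z⊙signed : ∀ x → z ⊙ signed (sign z) x ≈ ∣ z ∣ × x
    z⊙signed x = trans (⊙-abs z _) (×-congʳ ∣ z ∣ (signed-involutive (sign z) x))

  module _ {e} (e-annihilates : ∀ x → e × x ≈ ε) where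

    ×-multiple-of-exponent : ∀ q x → (q ℕ.* e) × x ≈ ε
    ×-multiple-of-exponent q x = begin
      (q ℕ.* e) × x ≈⟨ sym (×-assocˡ x q e) ⟩
      q × e × x     ≈⟨ ×-congʳ q (e-annihilates x) ⟩
      q × ε         ≈⟨ ×-ε q ⟩
      ε             ∎

    gcd×⊆× : ∀ n x → ∃ λ y → gcd n e × x ≈ n × y
    gcd×⊆× n x = fromBézout (Bézout.identity (gcd-GCD n e))
      where
      d = gcd n e
      fromBézout : Bézout.Identity d n e → ∃ λ y → d × x ≈ n × y
      fromBézout (Bézout.+- u v d+ve≡un) = u × x , (begin
        d × x                   ≈⟨ sym (identityʳ _) ⟩
        d × x ∙ ε               ≈⟨ ∙-congˡ (sym (×-multiple-of-exponent v x)) ⟩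
        d × x ∙ (v ℕ.* e) × x   ≈⟨ sym (×-homo-+ x d (v ℕ.* e)) ⟩
        (d ℕ.+ v ℕ.* e) × x     ≡⟨ ≡.cong (_× x) (≡.trans d+ve≡un (ℕ.*-comm u n)) ⟩
        (n ℕ.* u) × x           ≈⟨ sym (×-assocˡ x n u) ⟩
        n × u × x               ∎)
      fromBézout (Bézout.-+ u v d+un≡ve) = (u × x) ⁻¹ , (begin
        d × x                   ≈⟨ inverseˡ-unique _ _ d×x∙un×x≈ε ⟩
        ((u ℕ.* n) × x) ⁻¹      ≡⟨ ≡.cong (λ m → (m × x) ⁻¹) (ℕ.*-comm u n) ⟩
        ((n ℕ.* u) × x) ⁻¹      ≈⟨ ⁻¹-cong (sym (×-assocˡ x n u)) ⟩
        (n × u × x) ⁻¹          ≈⟨ sym (×-⁻¹ n (u × x)) ⟩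
        n × ((u × x) ⁻¹)        ∎)
        where
        d×x∙un×x≈ε : d × x ∙ (u ℕ.* n) × x ≈ ε
        d×x∙un×x≈ε = begin
          d × x ∙ (u ℕ.* n) × x ≈⟨ sym (×-homo-+ x d (u ℕ.* n)) ⟩
          (d ℕ.+ u ℕ.* n) × x   ≡⟨ ≡.cong (_× x) d+un≡ve ⟩
          (v ℕ.* e) × x         ≈⟨ ×-multiple-of-exponent v x ⟩
          ε                     ∎

    ×⊆gcd× : ∀ n x → ∃ λ y → n × x ≈ gcd n e × y
    ×⊆gcd× n x with gcd[m,n]∣m n e
    ... | divides q n≡qd = q × x , (begin
      n × x                 ≡⟨ ≡.cong (_× x) (≡.trans n≡qd (ℕ.*-comm q (gcd n e))) ⟩
      (gcd n e ℕ.* q) × x   ≈⟨ sym (×-assocˡ x (gcd n e) q) ⟩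
      gcd n e × q × x       ∎)

    ·G-gcd : ∀ n → _·G G (+ n) ≐ _·G G (+ gcd n e)
    ·G-gcd n = (λ { (x , y≈n×x) → let z , n×x≈d×z = ×⊆gcd× n x in z , trans y≈n×x n×x≈d×z })
             , (λ { (x , y≈d×x) → let z , d×x≈n×z = gcd×⊆× n x in z , trans y≈d×x d×x≈n×z })

    ·G≐gcd·G : ∀ z → _·G G z ≐ _·G G (+ gcd ∣ z ∣ e)
    ·G≐gcd·G z = ≐-trans (·G-abs z) (·G-gcd ∣ z ∣)

  weightedSum-cong : ∀ {k} (I : Subset k) {v w : Fin k → ℤ} {g h : Fin k → Carrier} →
    (∀ i → i ∈ I → v i ⊙ g i ≈ w i ⊙ h i) → weightedSum G I v g ≈ weightedSum G I w h
  weightedSum-cong {ℕ.zero}  I           eq = refl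
  weightedSum-cong {ℕ.suc k} (true ∷ I)  eq =
    ∙-cong (eq zero here) (weightedSum-cong I (λ i i∈I → eq (suc i) (there i∈I)))
  weightedSum-cong {ℕ.suc k} (false ∷ I) eq =
    weightedSum-cong I (λ i i∈I → eq (suc i) (there i∈I))

  module _ {a} {A : Pred ℤ a} (b : ℤ) where

    scaled-zeroSum : ∀ {k} (g : Fin k → Carrier) →
      HasWeightedZeroSum G A (λ i → b ⊙ g i) → HasWeightedZeroSum G (b ·ₛ A) g
    scaled-zeroSum g (I , I≢∅ , w , w∈A , sum≈ε) =
      I , I≢∅ , (λ i → b ℤ.* w i) , (λ i i∈I → w i , w∈A i i∈I , ≡.refl) ,
      trans (weightedSum-cong I (λ i _ → *-⊙ b (w i) (g i))) sum≈ε

    unscaled-zeroSum : ∀ {k} (g h : Fin k → Carrier) → (∀ i → h i ≈ b ⊙ g i) →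
      HasWeightedZeroSum G (b ·ₛ A) g → HasWeightedZeroSum G A h
    unscaled-zeroSum g h h≈bg (I , I≢∅ , w , w∈bA , sum≈ε) =
      I , I≢∅ , v , (λ i i∈I → proj₁ (v-spec i i∈I)) ,
      trans (weightedSum-cong I vh≈wg) sum≈ε
      where
      chosen = choose-on-subset (+ 0) I w∈bA
      v = proj₁ chosen
      v-spec = proj₂ chosen
      vh≈wg : ∀ i → i ∈ I → v i ⊙ h i ≈ w i ⊙ g i
      vh≈wg i i∈I = begin
        v i ⊙ h i         ≈⟨ ⊙-congʳ (v i) (h≈bg i) ⟩
        v i ⊙ b ⊙ g i     ≈⟨ sym (*-⊙ b (v i) (g i)) ⟩
        (b ℤ.* v i) ⊙ g i ≡⟨ ≡.cong (_⊙ g i) (≡.sym (proj₂ (v-spec i i∈I))) ⟩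
        w i ⊙ g i         ∎

    DavenportBound-scale : ∀ m →
      DavenportBound G (b ·ₛ A) (whole G) m ⇔ DavenportBound G A (_·G G b) m
    DavenportBound-scale m = mk⇔
      (λ D k m≤k h h∈bG →
        let g = λ i → proj₁ (h∈bG i) in
        unscaled-zeroSum g h (λ i → proj₂ (h∈bG i)) (D k m≤k g (λ _ → tt)))
      (λ D k m≤k g _ → scaled-zeroSum g (D k m≤k (λ i → b ⊙ g i) (λ i → g i , refl)))

  module _ {a} {A : Pred ℤ a} where

    DavenportBound-antitone : ∀ {h h′} {H : Pred Carrier h} {H′ : Pred Carrier h′} →
      H′ ⊆ H → ∀ {m} → DavenportBound G A H m → DavenportBound G A H′ m
    DavenportBound-antitone H′⊆H D k m≤k g g∈H′ = D k m≤k g (λ i → H′⊆H (g∈H′ i))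

    DavenportBound-≐ : ∀ {h h′} {H : Pred Carrier h} {H′ : Pred Carrier h′} →
      H ≐ H′ → ∀ m → DavenportBound G A H m ⇔ DavenportBound G A H′ m
    DavenportBound-≐ {H = H} {H′} (H⊆H′ , H′⊆H) m = mk⇔
      (DavenportBound-antitone {H = H} {H′} H′⊆H {m})
      (DavenportBound-antitone {H = H′} {H} H⊆H′ {m})

  IsWeightedDavenport-cong : ∀ {a a′ h h′} {A : Pred ℤ a} {A′ : Pred ℤ a′}
    {H : Pred Carrier h} {H′ : Pred Carrier h′} →
    (∀ m → DavenportBound G A H m ⇔ DavenportBound G A′ H′ m) →
    ∀ n → IsWeightedDavenport G A H n ⇔ IsWeightedDavenport G A′ H′ n
  IsWeightedDavenport-cong D⇔D′ n = mk⇔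
    (λ (1≤n , D , least) → 1≤n , to (D⇔D′ n) D , λ m 1≤m D′ → least m 1≤m (from (D⇔D′ m) D′))
    (λ (1≤n , D′ , least) → 1≤n , from (D⇔D′ n) D′ , λ m 1≤m D → least m 1≤m (to (D⇔D′ m) D))
    where open Equivalence

proposition2p3 : ∀ {c ℓ a : Level} (G : AbelianGroup c ℓ) → IsFinite G →
    (A : Pred ℤ a) → ∃ A → (b : ℤ) → (e : ℕ) → IsExponent G e →
    ∀ n → IsWeightedDavenport G (b ·ₛ A) (whole G) n
      ⇔ IsWeightedDavenport G A (_·G G (+ gcd ∣ b ∣ e)) n
proposition2p3 G _ A _ b e (_ , e-annihilates , _) =
  IsWeightedDavenport-cong G {A = b ·ₛ A} {A} {whole G} {_·G G (+ gcd ∣ b ∣ e)} λ m →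
    DavenportBound-≐ G {A = A} (·G≐gcd·G G e-annihilates b) m ⇔-∘ DavenportBound-scale G {A = A} b m
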